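{- Let $G$ be a graph and $S\subseteq V(G)$. Then $S$ is a minimal zero forcing set of $G$ if and only if $S$ is a maximal ZIr-set of $G$ and $S\cap F\neq\emptyset$ for every fort $F$ of $G$.
   Context: All graphs are simple, undirected, finite, with nonempty vertex set. Zero forcing: starting from a set $B$ of blue vertices, repeatedly apply the rule that a blue vertex $u$ may change a white vertex $w$ to blue if $w$ is the only white neighbor of $u$; $B$ is a zero forcing set if eventually all vertices are blue; it is minimal if no proper subset is a zero forcing set. A fort of $G$ is a nonempty $F\subseteq V(G)$ such that every $v\in V(G)\setminus F$ has $|F\cap N(v)|\neq 1$. For $S\subseteq V(G)$ and $x\in S$, a private fort of $x$ (relative to $S$) is a fort $F$ with $S\cap F=\{x\}$. $S$ is a ZIr-set if every element of $S$ has a private fort relative to $S$; a maximal ZIr-set is a ZIr-set not properly contained in another ZIr-set. -}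

module Defs where

open import Data.Nat using (ℕ; suc)
open import Data.Bool using (Bool; true; false)
open import Data.Fin using (Fin)
open import Data.Fin.Subset
  using (Subset; _∈_; _∉_; _⊆_; _⊂_; _∩_; _∪_; ⁅_⁆; ⊤; ∣_∣; Nonempty)
open import Data.Vec using (tabulate)
open import Data.Product using (Σ; _×_)
open import Relation.Binary.PropositionalEquality using (_≡_; _≢_)
open import Relation.Nullary using (¬_)

record Graph : Set where
  field
    n       : ℕ
    adj     : Fin (suc n) → Fin (suc n) → Bool
    sym     : ∀ u v → adj u v ≡ adj v u
    irrefl  : ∀ v → adj v v ≡ false

module _ (G : Graph) where
  open Graph G

  V : Set
  V = Fin (suc n)

  VSet : Set
  VSet = Subset (suc n)

  N : V → VSet
  N v = tabulate (adj v)

  -- one application of the color change rule: blue u forces white w,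
  -- w being the only white neighbour of u
  data ForceStep (B : VSet) : VSet → Set where
    force : (u w : V) → u ∈ B → w ∉ B → adj u w ≡ true →
            (∀ v → adj u v ≡ true → v ≢ w → v ∈ B) →
            ForceStep B (B ∪ ⁅ w ⁆)

  data Forces (B : VSet) : VSet → Set where
    done : Forces B B
    step : ∀ {C D} → ForceStep B C → Forces C D → Forces B D

  IsZeroForcingSet : VSet → Set
  IsZeroForcingSet B = Forces B ⊤

  IsMinimalZeroForcingSet : VSet → Set
  IsMinimalZeroForcingSet S =
    IsZeroForcingSet S × (∀ T → T ⊂ S → ¬ IsZeroForcingSet T)

  IsFort : VSet → Set
  IsFort F = Nonempty F × (∀ v → v ∉ F → ∣ F ∩ N v ∣ ≢ 1)

  IsPrivateFort : VSet → V → VSet → Set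
  IsPrivateFort S x F = IsFort F × (S ∩ F ≡ ⁅ x ⁆)

  IsZIrSet : VSet → Set
  IsZIrSet S = ∀ x → x ∈ S → Σ VSet (IsPrivateFort S x)

  IsMaximalZIrSet : VSet → Set
  IsMaximalZIrSet S = IsZIrSet S × (∀ T → S ⊂ T → ¬ IsZIrSet T)

{-# OPTIONS --safe #-}
module Submission where

-- A set is zero forcing exactly when it meets every fort: forcing never
-- turns a vertex of a fort avoided by the blue set blue, and once no force
-- applies, the white vertices form a fort.  A minimal zero forcing set S
-- therefore has, for each x ∈ S, a fort avoiding S - x, which S meets only
-- in x: a private fort of x.  Conversely a private fort of x relative to a
-- ZIr-set S is avoided by every subset of S missing x, so no proper subset
-- of S is zero forcing and no proper superset of a set meeting every fort
-- is a ZIr-set.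

open import Defs
open import Data.Nat using (ℕ; _<_)
open import Data.Nat.Properties using (<-irrefl)
open import Data.Bool using (true)
import Data.Bool.Properties as Bool
open import Data.Fin using (Fin; _≟_)
open import Data.Fin.Properties using (any?; all?)
open import Data.Fin.Subset
  using (Subset; _∈_; _∉_; _⊆_; _⊂_; _⊃_; _∩_; _∪_; _-_; ⁅_⁆; ⊤; ∁; ∣_∣; Nonempty; Empty)
open import Data.Fin.Subset.Properties
open import Data.Fin.Subset.Induction using (Acc; acc; ⊃-wellFounded)
open import Data.Vec using (tabulate)
open import Data.Vec.Properties using ([]=⇒lookup; lookup⇒[]=; lookup∘tabulate)
open import Data.Product using (_×_; _,_; ∃; ∃₂; Σ)
open import Data.Sum using (_⊎_; inj₁; inj₂)
open import Function.Base using (id; _∘_)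
open import Function.Bundles using (_⇔_; mk⇔)
open import Relation.Binary.PropositionalEquality
  using (_≡_; _≢_; refl; sym; trans; cong; subst; subst₂)
open import Relation.Nullary using (¬_; Dec; yes; no; contradiction)
open import Relation.Nullary.Decidable using (_×-dec_; _→-dec_; ¬?; decidable-stable)

private
  variable
    m : ℕ
    p q r : Subset m
    x : Fin m

x∈p⇒⁅x⁆⊆p : x ∈ p → ⁅ x ⁆ ⊆ p
x∈p⇒⁅x⁆⊆p {x = x} {p = p} x∈p y∈⁅x⁆ = subst (_∈ p) (sym (x∈⁅y⁆⇒x≡y x y∈⁅x⁆)) x∈p

≡⁅x⁆⁺ : x ∈ p → (∀ {y} → y ∈ p → y ≡ x) → p ≡ ⁅ x ⁆
≡⁅x⁆⁺ {x = x} x∈p only-x = ⊆-antisym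
  (λ y∈p → subst (_∈ ⁅ x ⁆) (sym (only-x y∈p)) (x∈⁅x⁆ x))
  (x∈p⇒⁅x⁆⊆p x∈p)

≡⁅x⁆⁻ : p ≡ ⁅ x ⁆ → x ∈ p × (∀ {y} → y ∈ p → y ≡ x)
≡⁅x⁆⁻ {x = x} refl = x∈⁅x⁆ x , x∈⁅y⁆⇒x≡y x

Empty[p-x∩q]⇒p∩q≡⁅x⁆ : Nonempty (p ∩ q) → Empty ((p - x) ∩ q) → p ∩ q ≡ ⁅ x ⁆
Empty[p-x∩q]⇒p∩q≡⁅x⁆ {p = p} {q = q} {x = x} (z , z∈p∩q) empty =
  ≡⁅x⁆⁺ (subst (_∈ p ∩ q) (only-x z∈p∩q) z∈p∩q) only-x
  where
  only-x : ∀ {y} → y ∈ p ∩ q → y ≡ x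
  only-x {y} y∈p∩q = decidable-stable (y ≟ x) λ y≢x →
    let y∈p , y∈q = x∈p∩q⁻ p q y∈p∩q
    in empty (y , x∈p∩q⁺ (x∈p∧x≢y⇒x∈p-y y∈p y≢x , y∈q))

p⊆q∧x∉p∧q∩r≡⁅x⁆⇒Empty[p∩r] : p ⊆ q → x ∉ p → q ∩ r ≡ ⁅ x ⁆ → Empty (p ∩ r)
p⊆q∧x∉p∧q∩r≡⁅x⁆⇒Empty[p∩r] {p = p} {r = r} p⊆q x∉p q∩r≡⁅x⁆ (y , y∈p∩r) =
  let y∈p , y∈r = x∈p∩q⁻ p r y∈p∩r
      _ , only-x = ≡⁅x⁆⁻ q∩r≡⁅x⁆
  in x∉p (subst (_∈ p) (only-x (x∈p∩q⁺ (p⊆q y∈p , y∈r))) y∈p)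

p⊆q∧Empty[q∩r]⇒Empty[p∩r] : p ⊆ q → Empty (q ∩ r) → Empty (p ∩ r)
p⊆q∧Empty[q∩r]⇒Empty[p∩r] {p = p} {r = r} p⊆q empty (y , y∈p∩r) =
  let y∈p , y∈r = x∈p∩q⁻ p r y∈p∩r in empty (y , x∈p∩q⁺ (p⊆q y∈p , y∈r))

x∉p⇒p⊂p∪⁅x⁆ : x ∉ p → p ⊂ p ∪ ⁅ x ⁆
x∉p⇒p⊂p∪⁅x⁆ {x = x} {p = p} x∉p = p⊆p∪q ⁅ x ⁆ , x , q⊆p∪q p ⁅ x ⁆ (x∈⁅x⁆ x) , x∉p

Empty[p∩∁p] : Empty (p ∩ ∁ p)
Empty[p∩∁p] {p = p} (x , x∈p∩∁p) =
  let x∈p , x∈∁p = x∈p∩q⁻ p (∁ p) x∈p∩∁p in x∈p⇒x∉∁p x∈p x∈∁p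

Empty[∁p]⇒p≡⊤ : Empty (∁ p) → p ≡ ⊤
Empty[∁p]⇒p≡⊤ empty = ⊆-antisym ⊆⊤ λ {x} _ → x∉∁p⇒x∈p λ x∈∁p → empty (x , x∈∁p)

∣p∣≡1⇒p≡⁅x⁆ : ∀ (p : Subset m) → ∣ p ∣ ≡ 1 → ∃ λ x → p ≡ ⁅ x ⁆
∣p∣≡1⇒p≡⁅x⁆ {m} p ∣p∣≡1 with nonempty? p
... | no empty = contradiction (trans (sym ∣p∣≡0) ∣p∣≡1) λ ()
  where
  ∣p∣≡0 : ∣ p ∣ ≡ 0
  ∣p∣≡0 = trans (cong ∣_∣ (Empty-unique empty)) (∣⊥∣≡0 m)
... | yes (x , x∈p) = x , ≡⁅x⁆⁺ x∈p only-x
  where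
  only-x : ∀ {y} → y ∈ p → y ≡ x
  only-x {y} y∈p = decidable-stable (y ≟ x) λ y≢x →
    <-irrefl refl (subst₂ _<_ (∣⁅x⁆∣≡1 x) ∣p∣≡1
      (p⊂q⇒∣p∣<∣q∣ (x∈p⇒⁅x⁆⊆p x∈p , y , y∈p , x≢y⇒x∉⁅y⁆ y≢x)))

module ZeroForcing (G : Graph) where
  open Graph G using (adj)

  private
    variable
      B C F : VSet G
      u w : V G

  ∈N⇒adj : w ∈ N G u → adj u w ≡ true
  ∈N⇒adj {w = w} {u = u} w∈Nu = trans (sym (lookup∘tabulate (adj u) w)) ([]=⇒lookup w∈Nu)

  adj⇒∈N : adj u w ≡ true → w ∈ N G u
  adj⇒∈N {u = u} {w = w} uw =
    lookup⇒[]= w (tabulate (adj u)) (trans (lookup∘tabulate (adj u) w) uw)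

  CanForce : VSet G → V G → V G → Set
  CanForce B u w = u ∈ B × w ∉ B × adj u w ≡ true × (∀ v → adj u v ≡ true → v ≢ w → v ∈ B)

  canForce? : ∀ B → Dec (∃₂ (CanForce B))
  canForce? B = any? λ u → any? λ w →
    (u ∈? B) ×-dec ¬? (w ∈? B) ×-dec (adj u w Bool.≟ true) ×-dec
    all? λ v → (adj u v Bool.≟ true) →-dec ¬? (v ≟ w) →-dec (v ∈? B)

  AvoidingFort : VSet G → Set
  AvoidingFort B = Σ (VSet G) λ F → IsFort G F × Empty (B ∩ F)

  MeetsEveryFort : VSet G → Set
  MeetsEveryFort B = ∀ F → IsFort G F → Nonempty (B ∩ F)

  avoidingFort⇒¬meetsEveryFort : AvoidingFort B → ¬ MeetsEveryFort B
  avoidingFort⇒¬meetsEveryFort (F , fort , avoids) meets = avoids (meets F fort)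

  forced-∉-avoidedFort : IsFort G F → Empty (B ∩ F) → CanForce B u w → w ∉ F
  forced-∉-avoidedFort {F} {B} {u} {w} (_ , fort-rule) avoids (u∈B , _ , uw , others-blue) w∈F =
    fort-rule u u∉F (trans (cong ∣_∣ F∩Nu≡⁅w⁆) (∣⁅x⁆∣≡1 w))
    where
    u∉F : u ∉ F
    u∉F u∈F = avoids (u , x∈p∩q⁺ (u∈B , u∈F))

    F∩Nu≡⁅w⁆ : F ∩ N G u ≡ ⁅ w ⁆
    F∩Nu≡⁅w⁆ = ≡⁅x⁆⁺ (x∈p∩q⁺ (w∈F , adj⇒∈N uw)) λ {v} v∈F∩Nu →
      decidable-stable (v ≟ w) λ v≢w →
        let v∈F , v∈Nu = x∈p∩q⁻ F (N G u) v∈F∩Nu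
        in avoids (v , x∈p∩q⁺ (others-blue v (∈N⇒adj v∈Nu) v≢w , v∈F))

  forceStep-preserves-Empty∩ : IsFort G F → ForceStep G B C → Empty (B ∩ F) → Empty (C ∩ F)
  forceStep-preserves-Empty∩ {F} {B} fort (force u w u∈B w∉B uw others-blue) avoids (v , v∈C∩F)
    with v∈C , v∈F ← x∈p∩q⁻ (B ∪ ⁅ w ⁆) F v∈C∩F
    with x∈p∪q⁻ B ⁅ w ⁆ v∈C
  ... | inj₁ v∈B = avoids (v , x∈p∩q⁺ (v∈B , v∈F))
  ... | inj₂ v∈⁅w⁆ = forced-∉-avoidedFort fort avoids (u∈B , w∉B , uw , others-blue)
                       (subst (_∈ F) (x∈⁅y⁆⇒x≡y w v∈⁅w⁆) v∈F)

  forces-preserve-Empty∩ : IsFort G F → Forces G B C → Empty (B ∩ F) → Empty (C ∩ F)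
  forces-preserve-Empty∩ fort done = id
  forces-preserve-Empty∩ fort (step s fs) =
    forces-preserve-Empty∩ fort fs ∘ forceStep-preserves-Empty∩ fort s

  zeroForcing⇒meetsEveryFort : IsZeroForcingSet G B → MeetsEveryFort B
  zeroForcing⇒meetsEveryFort {B} zf F fort@((v , v∈F) , _) with nonempty? (B ∩ F)
  ... | yes meets = meets
  ... | no avoids = contradiction (v , x∈p∩q⁺ (∈⊤ , v∈F)) (forces-preserve-Empty∩ fort zf avoids)

  stalled⇒∁-satisfiesFortRule : ¬ ∃₂ (CanForce B) → ∀ v → v ∉ ∁ B → ∣ ∁ B ∩ N G v ∣ ≢ 1
  stalled⇒∁-satisfiesFortRule {B} stalled v v∉∁B ∣∁B∩Nv∣≡1
    with w , ∁B∩Nv≡⁅w⁆ ← ∣p∣≡1⇒p≡⁅x⁆ (∁ B ∩ N G v) ∣∁B∩Nv∣≡1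
    with w∈∁B∩Nv , only-w ← ≡⁅x⁆⁻ ∁B∩Nv≡⁅w⁆
    with w∈∁B , w∈Nv ← x∈p∩q⁻ (∁ B) (N G v) w∈∁B∩Nv
    = stalled (v , w , x∉∁p⇒x∈p v∉∁B , x∈∁p⇒x∉p w∈∁B , ∈N⇒adj w∈Nv , others-blue)
    where
    others-blue : ∀ x → adj v x ≡ true → x ≢ w → x ∈ B
    others-blue x vx x≢w = decidable-stable (x ∈? B) λ x∉B →
      x≢w (only-w (x∈p∩q⁺ (x∉p⇒x∈∁p x∉B , adj⇒∈N vx)))

  zeroForcing⊎avoidingFort : ∀ B → IsZeroForcingSet G B ⊎ AvoidingFort B
  zeroForcing⊎avoidingFort B = go B (⊃-wellFounded B)
    where
    go : ∀ B → Acc _⊃_ B → IsZeroForcingSet G B ⊎ AvoidingFort B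
    go B (acc larger) with nonempty? (∁ B) | canForce? B
    ... | no all-blue | _ = inj₁ (subst (Forces G B) (Empty[∁p]⇒p≡⊤ all-blue) done)
    ... | yes white | no stalled =
      inj₂ (∁ B , (white , stalled⇒∁-satisfiesFortRule stalled) , Empty[p∩∁p])
    ... | yes _ | yes (u , w , u∈B , w∉B , uw , others-blue)
      with go (B ∪ ⁅ w ⁆) (larger (x∉p⇒p⊂p∪⁅x⁆ w∉B))
    ...   | inj₁ zf = inj₁ (step (force u w u∈B w∉B uw others-blue) zf)
    ...   | inj₂ (F , fort , avoids) =
      inj₂ (F , fort , p⊆q∧Empty[q∩r]⇒Empty[p∩r] (p⊆p∪q ⁅ w ⁆) avoids)

  meetsEveryFort⇒zeroForcing : MeetsEveryFort B → IsZeroForcingSet G B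
  meetsEveryFort⇒zeroForcing {B} meets with zeroForcing⊎avoidingFort B
  ... | inj₁ zf = zf
  ... | inj₂ avoiding = contradiction meets (avoidingFort⇒¬meetsEveryFort avoiding)

  minimalZeroForcing⇒ZIrSet : IsMinimalZeroForcingSet G B → IsZIrSet G B
  minimalZeroForcing⇒ZIrSet {B} (zf , minimal) x x∈B with zeroForcing⊎avoidingFort (B - x)
  ... | inj₁ zf-x = contradiction zf-x (minimal (B - x) (x∈p⇒p-x⊂p x∈B))
  ... | inj₂ (F , fort , avoids) =
    F , fort , Empty[p-x∩q]⇒p∩q≡⁅x⁆ (zeroForcing⇒meetsEveryFort zf F fort) avoids

  ⊂ZIrSet⇒¬meetsEveryFort : IsZIrSet G B → C ⊂ B → ¬ MeetsEveryFort C
  ⊂ZIrSet⇒¬meetsEveryFort zIr (C⊆B , x , x∈B , x∉C) with F , fort , B∩F≡⁅x⁆ ← zIr x x∈B =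
    avoidingFort⇒¬meetsEveryFort (F , fort , p⊆q∧x∉p∧q∩r≡⁅x⁆⇒Empty[p∩r] C⊆B x∉C B∩F≡⁅x⁆)

proposition2p2 : (G : Graph) (S : VSet G) →
    IsMinimalZeroForcingSet G S ⇔
      (IsMaximalZIrSet G S × (∀ F → IsFort G F → Nonempty (S ∩ F)))
proposition2p2 G S = mk⇔ to from
  where
  open ZeroForcing G

  to : IsMinimalZeroForcingSet G S → IsMaximalZIrSet G S × MeetsEveryFort S
  to minimal@(zf , _) = (minimalZeroForcing⇒ZIrSet minimal , no-ZIr-superset) , meets
    where
    meets : MeetsEveryFort S
    meets = zeroForcing⇒meetsEveryFort zf

    no-ZIr-superset : ∀ T → S ⊂ T → ¬ IsZIrSet G T
    no-ZIr-superset T S⊂T zIrT = ⊂ZIrSet⇒¬meetsEveryFort zIrT S⊂T meets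

  from : IsMaximalZIrSet G S × MeetsEveryFort S → IsMinimalZeroForcingSet G S
  from ((zIr , _) , meets) = meetsEveryFort⇒zeroForcing meets , no-zeroForcing-subset
    where
    no-zeroForcing-subset : ∀ T → T ⊂ S → ¬ IsZeroForcingSet G T
    no-zeroForcing-subset T T⊂S zfT =
      ⊂ZIrSet⇒¬meetsEveryFort zIr T⊂S (zeroForcing⇒meetsEveryFort zfT)
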